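{- Let $D\in k[t]$ be negative, square-free, of odd degree, and let $C,C'\in\mathcal C_D$ (not necessarily distinct) with $Q=(a,b,c)\in C$ and $Q'=(a',b',c')\in C'$. (i) If $a$ and $a'$ are coprime, then every form in $C\otimes C'$ properly represents $aa'$. (ii) If $a$ is coprime to $D$, then every form in $C\otimes C$ properly represents $a^2$.
   Context: $k$ is a number field. A polynomial $n\in k[t]$ is positive if $n\neq0$ and the leading coefficient of $(-1)^{\deg n}n$ lies in $(k^\times)^2$; negative if $-n$ is positive. A form $(a,b,c)$ over $k[t]$ denotes $ax^2+2bxy+cy^2$ with discriminant $b^2-ac$; it properly represents $n$ if $n=Q(x,y)$ with $x,y\in k[t]$ coprime. $\mathcal Q_D$ is the set of forms of discriminant $D$ with $a$ positive; $\mathrm{SL}_2(k[t])$ acts by $Q|M(x,y)=Q(mx+ny,rx+sy)$, preserving $\mathcal Q_D$, and $\mathcal C_D$ is the set of orbits. $\mathcal C_D$ is an abelian group under composition $\otimes$: for classes $C,C'$ choose $(a,b,c)\in C,(a',b',c')\in C'$ with $\gcd(a,a',b+b')=1$; there are $e,f\in k[t]$ with $(a,e,a'f)\in C$, $(a',e,af)\in C'$, and $C\otimes C'$ is the (well-defined) class of $(aa',e,f)$; the identity is the class of $(1,0,-D)$. -}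

module Defs where

open import Level using (0ℓ)
open import Data.Nat as ℕ using (ℕ; zero; suc)
open import Data.Fin using (Fin)
open import Data.List using (List; []; _∷_; map; length; foldr)
open import Data.Product using (Σ; ∃; _×_; _,_)
open import Data.Rational as Q using (ℚ)
open import Relation.Nullary using (¬_; yes; no)
open import Relation.Binary.Definitions using (DecidableEquality)
open import Relation.Binary.PropositionalEquality using (_≡_; _≢_)
import Algebra.Structures as AS

-- A number field k: a field (with propositional equality and decidable
-- equality, as any concrete number field admits), together with a ring
-- embedding ℚ → k, such that k is finite-dimensional over ℚ.
record NumberField : Set₁ where
  infixl 6 _+_
  infixl 7 _*_
  field
    K    : Set
    _+_  : K → K → K
    _*_  : K → K → K
    -_   : K → K
    0#   : K
    1#   : K
    isCommutativeRing : AS.IsCommutativeRing {A = K} _≡_ _+_ _*_ -_ 0# 1#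
    0≢1  : 0# ≢ 1#
    inverse : (x : K) → x ≢ 0# → ∃ λ y → x * y ≡ 1#
    _≟_  : DecidableEquality K
    ι       : ℚ → K
    ι-1     : ι Q.1ℚ ≡ 1#
    ι-+     : ∀ p q → ι (p Q.+ q) ≡ ι p + ι q
    ι-*     : ∀ p q → ι (p Q.* q) ≡ ι p * ι q
    dim     : ℕ
    basis   : Fin dim → K
    spans   : (x : K) → ∃ λ (c : Fin dim → ℚ) →
                x ≡ foldr _+_ 0# (Data.List.tabulate (λ i → ι (c i) * basis i))

module Over (k : NumberField) where
  open NumberField k

  -- Polynomials in k[t] as coefficient lists (constant term first);
  -- equality is coefficientwise (trailing zeros irrelevant).
  Poly : Set
  Poly = List K

  coeff : Poly → ℕ → K
  coeff []      _       = 0#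
  coeff (a ∷ p) zero    = a
  coeff (a ∷ p) (suc i) = coeff p i

  infix 4 _≈ₚ_
  _≈ₚ_ : Poly → Poly → Set
  p ≈ₚ q = ∀ i → coeff p i ≡ coeff q i

  0ₚ 1ₚ 2ₚ : Poly
  0ₚ = []
  1ₚ = 1# ∷ []
  2ₚ = (1# + 1#) ∷ []

  infixl 6 _+ₚ_ _-ₚ_
  infixl 7 _*ₚ_
  _+ₚ_ : Poly → Poly → Poly
  []      +ₚ q       = q
  (a ∷ p) +ₚ []      = a ∷ p
  (a ∷ p) +ₚ (b ∷ q) = (a + b) ∷ (p +ₚ q)

  scale : K → Poly → Poly
  scale c = map (c *_)

  negₚ : Poly → Poly
  negₚ = map -_

  _-ₚ_ : Poly → Poly → Poly
  p -ₚ q = p +ₚ negₚ q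

  _*ₚ_ : Poly → Poly → Poly
  []      *ₚ q = []
  (a ∷ p) *ₚ q = scale a q +ₚ (0# ∷ (p *ₚ q))

  trim : Poly → Poly
  trim [] = []
  trim (a ∷ p) with trim p
  ... | b ∷ q = a ∷ b ∷ q
  ... | [] with a ≟ 0#
  ...   | yes _ = []
  ...   | no  _ = a ∷ []

  deg : Poly → ℕ
  deg p = length (trim p) ℕ.∸ 1

  lastK : List K → K
  lastK []          = 0#
  lastK (a ∷ [])    = a
  lastK (a ∷ b ∷ l) = lastK (b ∷ l)

  lc : Poly → K
  lc p = lastK (trim p)

  powK : K → ℕ → K
  powK x zero    = 1#
  powK x (suc n) = x * powK x n

  infix 4 _∣ₚ_
  _∣ₚ_ : Poly → Poly → Set
  p ∣ₚ q = ∃ λ r → r *ₚ p ≈ₚ q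

  Coprime : Poly → Poly → Set
  Coprime p q = ∀ d → d ∣ₚ p → d ∣ₚ q → d ∣ₚ 1ₚ

  Coprime₃ : Poly → Poly → Poly → Set
  Coprime₃ p q r = ∀ d → d ∣ₚ p → d ∣ₚ q → d ∣ₚ r → d ∣ₚ 1ₚ

  SquareFree : Poly → Set
  SquareFree D = ∀ p → (p *ₚ p) ∣ₚ D → p ∣ₚ 1ₚ

  OddDegree : Poly → Set
  OddDegree D = ∃ λ m → deg D ≡ suc (2 ℕ.* m)

  Positive : Poly → Set
  Positive n = (¬ (n ≈ₚ 0ₚ)) ×
    (∃ λ u → u * u ≡ lc (scale (powK (- 1#) (deg n)) n))

  Negative : Poly → Set
  Negative n = Positive (negₚ n)

  -- binary quadratic forms (a,b,c) = a x² + 2 b x y + c y²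
  record Form : Set where
    constructor form
    field
      fa fb fc : Poly
  open Form public

  disc : Form → Poly
  disc Q = (fb Q *ₚ fb Q) -ₚ (fa Q *ₚ fc Q)

  eval : Form → Poly → Poly → Poly
  eval Q x y = (fa Q *ₚ x *ₚ x) +ₚ (2ₚ *ₚ fb Q *ₚ x *ₚ y) +ₚ (fc Q *ₚ y *ₚ y)

  ProperlyRepresents : Form → Poly → Set
  ProperlyRepresents Q n = ∃ λ x → ∃ λ y → Coprime x y × eval Q x y ≈ₚ n

  InQ : Poly → Form → Set
  InQ D Q = (disc Q ≈ₚ D) × Positive (fa Q)

  record SL2 : Set where
    constructor mat
    field
      m n r s : Poly
      det≡1 : (m *ₚ s) -ₚ (n *ₚ r) ≈ₚ 1ₚ

  -- Q|M (x,y) = Q(mx+ny, rx+sy)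
  act : Form → SL2 → Form
  act Q (mat m n r s _) =
    form (eval Q m r)
         ((fa Q *ₚ m *ₚ n) +ₚ (fb Q *ₚ ((m *ₚ s) +ₚ (n *ₚ r))) +ₚ (fc Q *ₚ r *ₚ s))
         (eval Q n s)

  _≈F_ : Form → Form → Set
  Q ≈F R = (fa Q ≈ₚ fa R) × (fb Q ≈ₚ fb R) × (fc Q ≈ₚ fc R)

  _∼_ : Form → Form → Set
  Q ∼ R = ∃ λ M → act Q M ≈F R

  -- R ∈ C ⊗ C' in 𝒞_D, where C = [Q], C' = [Q'], following the definition
  -- of composition: representatives Q₁ ∈ C, Q₁' ∈ C' with
  -- gcd(a₁,a₁',b₁+b₁')=1, e f with (a₁,e,a₁'f) ∈ C, (a₁',e,a₁ f) ∈ C',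
  -- and R in the class of (a₁a₁', e, f).
  InComposite : Poly → Form → Form → Form → Set
  InComposite D Q Q' R =
    InQ D R ×
    ∃ λ Q₁ → ∃ λ Q₁' → ∃ λ e → ∃ λ f →
      InQ D Q₁ × InQ D Q₁' × Q ∼ Q₁ × Q' ∼ Q₁' ×
      Coprime₃ (fa Q₁) (fa Q₁') (fb Q₁ +ₚ fb Q₁') ×
      InQ D (form (fa Q₁) e (fa Q₁' *ₚ f)) × Q ∼ form (fa Q₁) e (fa Q₁' *ₚ f) ×
      InQ D (form (fa Q₁') e (fa Q₁ *ₚ f)) × Q' ∼ form (fa Q₁') e (fa Q₁ *ₚ f) ×
      InQ D (form (fa Q₁ *ₚ fa Q₁') e f) × form (fa Q₁ *ₚ fa Q₁') e f ∼ R

-- Unfold R ∈ [Q] ⊗ [Q'] into matrices M, M', N ∈ SL₂(k[t]) with Q|M = F = (A, E, A'f),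
-- Q'|M' = G = (A', E, Af) and H|N = R for H = (AA', E, f).  If (x₁, y₁) and (x₂, y₂) are the
-- first columns of M⁻¹ and M'⁻¹, then F(x₁, y₁) = a and G(x₂, y₂) = a', and Dirichlet's identity
-- H(X, Y) = F(x₁, y₁) G(x₂, y₂), for X = x₁x₂ − f y₁y₂ and Y = Ax₁y₂ + A'x₂y₁ + 2E y₁y₂, shows
-- that R represents aa' at N⁻¹(X, Y).  A common divisor of these coordinates divides X and Y,
-- hence F(x₁, y₁)x₂ and F(x₁, y₁)y₂, hence a because (x₂, y₂) is unimodular; symmetrically it
-- divides a', which gives (i).  In (ii), where Q' = Q, write M = (m n; r s), M' = (m' n'; r' s'):
-- such a divisor also divides b r r', b s s', b² s r' and b² r s', hence b² = b² det M det M',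
-- and so D = b² − ac.

module Submission where

open import Level using (0ℓ)
open import Data.Nat using (ℕ; zero; suc)
open import Data.List using ([]; _∷_)
open import Data.Product using (_×_; _,_; proj₁; proj₂; uncurry)
open import Relation.Binary.PropositionalEquality as ≡ using (_≡_; refl; cong; cong₂)
open import Algebra.Bundles using (CommutativeRing; RawRing)
import Algebra.Structures as AS
open import Data.Maybe using (Maybe; just; nothing)
open import Relation.Nullary using (yes; no)
open import Data.Rational as ℚ using (ℚ)
import Data.Rational.Properties as ℚ
open import Algebra.Solver.Ring.AlmostCommutativeRing
  using (fromCommutativeRing; _-Raw-AlmostCommutative⟶_)
import Algebra.Solver.Ring
open import Defs

coefficientRing : NumberField → CommutativeRing 0ℓ 0ℓ
coefficientRing k = record { isCommutativeRing = NumberField.isCommutativeRing k }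

module PolynomialRing (k : NumberField) where
  open NumberField k
  open Over k

  private
    module K = CommutativeRing (coefficientRing k)
    open import Algebra.Properties.Ring K.ring using (-0#≈0#)
    open import Algebra.Properties.CommutativeSemigroup K.+-commutativeSemigroup
      using () renaming (interchange to +-interchange)

  -- Coefficientwise equality, wrapped in a record so that both sides can be inferred.
  infix 4 _≋_
  record _≋_ (p q : Poly) : Set where
    constructor coeffwise
    field coeff-≡ : p ≈ₚ q
  open _≋_ public

  ≋-refl : ∀ {p} → p ≋ p
  ≋-refl = coeffwise λ _ → refl

  ≋-sym : ∀ {p q} → p ≋ q → q ≋ p
  ≋-sym e = coeffwise λ i → ≡.sym (coeff-≡ e i)

  ≋-trans : ∀ {p q r} → p ≋ q → q ≋ r → p ≋ r
  ≋-trans e f = coeffwise λ i → ≡.trans (coeff-≡ e i) (coeff-≡ f i)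

  ≡⇒≋ : ∀ {p q} → p ≡ q → p ≋ q
  ≡⇒≋ refl = ≋-refl

  ∷-cong : ∀ {a b p q} → a ≡ b → p ≋ q → (a ∷ p) ≋ (b ∷ q)
  ∷-cong a≡b p≋q = coeffwise λ where
    zero    → a≡b
    (suc i) → coeff-≡ p≋q i

  0∷-zero : ∀ {p} → p ≋ [] → (0# ∷ p) ≋ []
  0∷-zero p≋0 = coeffwise λ where
    zero    → refl
    (suc i) → coeff-≡ p≋0 i

  coeff-+ₚ : ∀ p q i → coeff (p +ₚ q) i ≡ coeff p i + coeff q i
  coeff-+ₚ []      q       i       = ≡.sym (K.+-identityˡ _)
  coeff-+ₚ (a ∷ p) []      i       = ≡.sym (K.+-identityʳ _)
  coeff-+ₚ (a ∷ p) (b ∷ q) zero    = refl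
  coeff-+ₚ (a ∷ p) (b ∷ q) (suc i) = coeff-+ₚ p q i

  coeff-scale : ∀ c p i → coeff (scale c p) i ≡ c * coeff p i
  coeff-scale c []      i       = ≡.sym (K.zeroʳ c)
  coeff-scale c (a ∷ p) zero    = refl
  coeff-scale c (a ∷ p) (suc i) = coeff-scale c p i

  coeff-negₚ : ∀ p i → coeff (negₚ p) i ≡ - coeff p i
  coeff-negₚ []      i       = ≡.sym -0#≈0#
  coeff-negₚ (a ∷ p) zero    = refl
  coeff-negₚ (a ∷ p) (suc i) = coeff-negₚ p i

  +ₚ-cong : ∀ {p p' q q'} → p ≋ p' → q ≋ q' → p +ₚ q ≋ p' +ₚ q'
  +ₚ-cong {p} {p'} {q} {q'} e f = coeffwise λ i → begin
    coeff (p +ₚ q) i           ≡⟨ coeff-+ₚ p q i ⟩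
    coeff p i + coeff q i      ≡⟨ cong₂ _+_ (coeff-≡ e i) (coeff-≡ f i) ⟩
    coeff p' i + coeff q' i    ≡⟨ coeff-+ₚ p' q' i ⟨
    coeff (p' +ₚ q') i         ∎
    where open ≡.≡-Reasoning

  negₚ-cong : ∀ {p p'} → p ≋ p' → negₚ p ≋ negₚ p'
  negₚ-cong {p} {p'} e = coeffwise λ i →
    ≡.trans (coeff-negₚ p i) (≡.trans (cong -_ (coeff-≡ e i)) (≡.sym (coeff-negₚ p' i)))

  scale-cong : ∀ c {p p'} → p ≋ p' → scale c p ≋ scale c p'
  scale-cong c {p} {p'} e = coeffwise λ i →
    ≡.trans (coeff-scale c p i) (≡.trans (cong (c *_) (coeff-≡ e i)) (≡.sym (coeff-scale c p' i)))

  +ₚ-comm : ∀ p q → p +ₚ q ≋ q +ₚ p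
  +ₚ-comm p q = coeffwise λ i →
    ≡.trans (coeff-+ₚ p q i) (≡.trans (K.+-comm _ _) (≡.sym (coeff-+ₚ q p i)))

  +ₚ-assoc : ∀ p q r → (p +ₚ q) +ₚ r ≋ p +ₚ (q +ₚ r)
  +ₚ-assoc p q r = coeffwise λ i → begin
    coeff ((p +ₚ q) +ₚ r) i                 ≡⟨ coeff-+ₚ (p +ₚ q) r i ⟩
    coeff (p +ₚ q) i + coeff r i            ≡⟨ cong (_+ coeff r i) (coeff-+ₚ p q i) ⟩
    (coeff p i + coeff q i) + coeff r i     ≡⟨ K.+-assoc _ _ _ ⟩
    coeff p i + (coeff q i + coeff r i)     ≡⟨ cong (coeff p i +_) (coeff-+ₚ q r i) ⟨
    coeff p i + coeff (q +ₚ r) i            ≡⟨ coeff-+ₚ p (q +ₚ r) i ⟨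
    coeff (p +ₚ (q +ₚ r)) i                 ∎
    where open ≡.≡-Reasoning

  +ₚ-identityʳ : ∀ p → p +ₚ [] ≋ p
  +ₚ-identityʳ []      = ≋-refl
  +ₚ-identityʳ (a ∷ p) = ≋-refl

  +ₚ-inverseʳ : ∀ p → p +ₚ negₚ p ≋ []
  +ₚ-inverseʳ p = coeffwise λ i →
    ≡.trans (coeff-+ₚ p (negₚ p) i)
      (≡.trans (cong (coeff p i +_) (coeff-negₚ p i)) (K.-‿inverseʳ _))

  +ₚ-inverseˡ : ∀ p → negₚ p +ₚ p ≋ []
  +ₚ-inverseˡ p = ≋-trans (+ₚ-comm (negₚ p) p) (+ₚ-inverseʳ p)

  +ₚ-interchange : ∀ p q r s → (p +ₚ q) +ₚ (r +ₚ s) ≋ (p +ₚ r) +ₚ (q +ₚ s)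
  +ₚ-interchange p q r s = coeffwise λ i → begin
    coeff ((p +ₚ q) +ₚ (r +ₚ s)) i                     ≡⟨ coeff-+ₚ (p +ₚ q) (r +ₚ s) i ⟩
    coeff (p +ₚ q) i + coeff (r +ₚ s) i                ≡⟨ cong₂ _+_ (coeff-+ₚ p q i) (coeff-+ₚ r s i) ⟩
    (coeff p i + coeff q i) + (coeff r i + coeff s i)  ≡⟨ +-interchange _ _ _ _ ⟩
    (coeff p i + coeff r i) + (coeff q i + coeff s i)  ≡⟨ cong₂ _+_ (coeff-+ₚ p r i) (coeff-+ₚ q s i) ⟨
    coeff (p +ₚ r) i + coeff (q +ₚ s) i                ≡⟨ coeff-+ₚ (p +ₚ r) (q +ₚ s) i ⟨
    coeff ((p +ₚ r) +ₚ (q +ₚ s)) i                     ∎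
    where open ≡.≡-Reasoning

  scale-distribʳ : ∀ a b p → scale (a + b) p ≋ scale a p +ₚ scale b p
  scale-distribʳ a b p = coeffwise λ i →
    ≡.trans (coeff-scale (a + b) p i) (≡.trans (K.distribʳ _ _ _)
      (≡.sym (≡.trans (coeff-+ₚ (scale a p) (scale b p) i)
                      (cong₂ _+_ (coeff-scale a p i) (coeff-scale b p i)))))

  scale-distribˡ : ∀ a p q → scale a (p +ₚ q) ≋ scale a p +ₚ scale a q
  scale-distribˡ a p q = coeffwise λ i →
    ≡.trans (coeff-scale a (p +ₚ q) i) (≡.trans (cong (a *_) (coeff-+ₚ p q i))
      (≡.trans (K.distribˡ _ _ _)
        (≡.sym (≡.trans (coeff-+ₚ (scale a p) (scale a q) i)
                        (cong₂ _+_ (coeff-scale a p i) (coeff-scale a q i))))))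

  scale-* : ∀ a b p → scale (a * b) p ≋ scale a (scale b p)
  scale-* a b p = coeffwise λ i →
    ≡.trans (coeff-scale (a * b) p i) (≡.trans (K.*-assoc _ _ _)
      (≡.trans (cong (a *_) (≡.sym (coeff-scale b p i))) (≡.sym (coeff-scale a (scale b p) i))))

  scale-0 : ∀ p → scale 0# p ≋ []
  scale-0 p = coeffwise λ i → ≡.trans (coeff-scale 0# p i) (K.zeroˡ _)

  scale-1 : ∀ p → scale 1# p ≋ p
  scale-1 p = coeffwise λ i → ≡.trans (coeff-scale 1# p i) (K.*-identityˡ _)

  0∷-shift-+ₚ : ∀ p q → (0# ∷ (p +ₚ q)) ≋ (0# ∷ p) +ₚ (0# ∷ q)
  0∷-shift-+ₚ p q = ∷-cong (≡.sym (K.+-identityˡ 0#)) ≋-refl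

  *ₚ-zeroˡ : ∀ {z} q → z ≋ [] → z *ₚ q ≋ []
  *ₚ-zeroˡ {[]}    q _   = ≋-refl
  *ₚ-zeroˡ {a ∷ z} q z≋0 =
    +ₚ-cong (≋-trans (≡⇒≋ (cong (λ c → scale c q) (coeff-≡ z≋0 zero))) (scale-0 q))
            (0∷-zero (*ₚ-zeroˡ {z} q (coeffwise λ i → coeff-≡ z≋0 (suc i))))

  *ₚ-congʳ : ∀ {p p'} q → p ≋ p' → p *ₚ q ≋ p' *ₚ q
  *ₚ-congʳ {[]}    {[]}     q e = ≋-refl
  *ₚ-congʳ {[]}    {a ∷ p'} q e = ≋-sym (*ₚ-zeroˡ q (≋-sym e))
  *ₚ-congʳ {a ∷ p} {[]}     q e = *ₚ-zeroˡ q e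
  *ₚ-congʳ {a ∷ p} {a' ∷ p'} q e with coeff-≡ e zero
  ... | refl = +ₚ-cong ≋-refl (∷-cong refl (*ₚ-congʳ {p} {p'} q (coeffwise λ i → coeff-≡ e (suc i))))

  *ₚ-congˡ : ∀ p {q q'} → q ≋ q' → p *ₚ q ≋ p *ₚ q'
  *ₚ-congˡ []      e = ≋-refl
  *ₚ-congˡ (a ∷ p) e = +ₚ-cong (scale-cong a e) (∷-cong refl (*ₚ-congˡ p e))

  *ₚ-cong : ∀ {p p' q q'} → p ≋ p' → q ≋ q' → p *ₚ q ≋ p' *ₚ q'
  *ₚ-cong {_} {p'} {q} e f = ≋-trans (*ₚ-congʳ q e) (*ₚ-congˡ p' f)

  *ₚ-distribʳ : ∀ r p q → (p +ₚ q) *ₚ r ≋ (p *ₚ r) +ₚ (q *ₚ r)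
  *ₚ-distribʳ r []      q       = ≋-refl
  *ₚ-distribʳ r (a ∷ p) []      = ≋-sym (+ₚ-identityʳ _)
  *ₚ-distribʳ r (a ∷ p) (b ∷ q) =
    ≋-trans (+ₚ-cong (scale-distribʳ a b r)
                     (≋-trans (∷-cong refl (*ₚ-distribʳ r p q)) (0∷-shift-+ₚ (p *ₚ r) (q *ₚ r))))
            (+ₚ-interchange (scale a r) (scale b r) (0# ∷ (p *ₚ r)) (0# ∷ (q *ₚ r)))

  *ₚ-distribˡ : ∀ p q r → p *ₚ (q +ₚ r) ≋ (p *ₚ q) +ₚ (p *ₚ r)
  *ₚ-distribˡ []      q r = ≋-refl
  *ₚ-distribˡ (a ∷ p) q r =
    ≋-trans (+ₚ-cong (scale-distribˡ a q r)
                     (≋-trans (∷-cong refl (*ₚ-distribˡ p q r)) (0∷-shift-+ₚ (p *ₚ q) (p *ₚ r))))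
            (+ₚ-interchange (scale a q) (scale a r) (0# ∷ (p *ₚ q)) (0# ∷ (p *ₚ r)))

  scale-*ₚ : ∀ a q r → scale a q *ₚ r ≋ scale a (q *ₚ r)
  scale-*ₚ a []      r = ≋-refl
  scale-*ₚ a (b ∷ q) r =
    ≋-trans (+ₚ-cong (scale-* a b r) (∷-cong (≡.sym (K.zeroʳ a)) (scale-*ₚ a q r)))
            (≋-sym (scale-distribˡ a (scale b r) (0# ∷ (q *ₚ r))))

  *ₚ-assoc : ∀ p q r → (p *ₚ q) *ₚ r ≋ p *ₚ (q *ₚ r)
  *ₚ-assoc []      q r = ≋-refl
  *ₚ-assoc (a ∷ p) q r =
    ≋-trans (*ₚ-distribʳ r (scale a q) (0# ∷ (p *ₚ q)))
      (+ₚ-cong (scale-*ₚ a q r)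
               (≋-trans (+ₚ-cong (scale-0 r) ≋-refl) (∷-cong refl (*ₚ-assoc p q r))))

  *ₚ-zeroʳ : ∀ p → p *ₚ [] ≋ []
  *ₚ-zeroʳ []      = ≋-refl
  *ₚ-zeroʳ (a ∷ p) = 0∷-zero (*ₚ-zeroʳ p)

  *ₚ-∷ : ∀ p b q → p *ₚ (b ∷ q) ≋ scale b p +ₚ (0# ∷ (p *ₚ q))
  *ₚ-∷ []      b q = ≋-sym (0∷-zero ≋-refl)
  *ₚ-∷ (a ∷ p) b q =
    ∷-cong (cong (_+ 0#) (K.*-comm a b))
      (≋-trans (+ₚ-cong ≋-refl (*ₚ-∷ p b q))
               (≋-trans (≋-sym (+ₚ-assoc (scale a q) (scale b p) _))
                        (≋-trans (+ₚ-cong (+ₚ-comm (scale a q) (scale b p)) ≋-refl)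
                                 (+ₚ-assoc (scale b p) (scale a q) _))))

  *ₚ-comm : ∀ p q → p *ₚ q ≋ q *ₚ p
  *ₚ-comm []      q = ≋-sym (*ₚ-zeroʳ q)
  *ₚ-comm (a ∷ p) q = ≋-trans (+ₚ-cong ≋-refl (∷-cong refl (*ₚ-comm p q))) (≋-sym (*ₚ-∷ q a p))

  *ₚ-identityˡ : ∀ p → 1ₚ *ₚ p ≋ p
  *ₚ-identityˡ p = ≋-trans (+ₚ-cong (scale-1 p) (0∷-zero ≋-refl)) (+ₚ-identityʳ p)

  *ₚ-identityʳ : ∀ p → p *ₚ 1ₚ ≋ p
  *ₚ-identityʳ p = ≋-trans (*ₚ-comm p 1ₚ) (*ₚ-identityˡ p)

  isCommutativeRingₚ : AS.IsCommutativeRing _≋_ _+ₚ_ _*ₚ_ negₚ [] 1ₚ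
  isCommutativeRingₚ = record
    { isRing = record
      { +-isAbelianGroup = record
        { isGroup = record
          { isMonoid = record
            { isSemigroup = record
              { isMagma = record
                { isEquivalence = record { refl = ≋-refl ; sym = ≋-sym ; trans = ≋-trans }
                ; ∙-cong = +ₚ-cong }
              ; assoc = +ₚ-assoc }
            ; identity = (λ _ → ≋-refl) , +ₚ-identityʳ }
          ; inverse = +ₚ-inverseˡ , +ₚ-inverseʳ
          ; ⁻¹-cong = negₚ-cong }
        ; comm = +ₚ-comm }
      ; *-cong = *ₚ-cong
      ; *-assoc = *ₚ-assoc
      ; *-identity = *ₚ-identityˡ , *ₚ-identityʳ
      ; distrib = *ₚ-distribˡ , λ x y z → *ₚ-distribʳ x y z }
    ; *-comm = *ₚ-comm }

  commutativeRingₚ : CommutativeRing 0ℓ 0ℓ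
  commutativeRingₚ = record { isCommutativeRing = isCommutativeRingₚ }

  open CommutativeRing commutativeRingₚ public using () renaming (setoid to setoidₚ)

-- A ring solver for k[t] whose constants are rationals, so that identities involving 2 and 1/2
-- are decided by computing in ℚ.
module PolynomialSolver (k : NumberField) where
  open NumberField k
  open Over k
  open PolynomialRing k

  private
    module K = CommutativeRing (coefficientRing k)
    open import Algebra.Properties.Ring K.ring using (x+x≈x⇒x≈0)
    open import Algebra.Properties.Group K.+-group using (inverseʳ-unique)

  ι-0 : ι ℚ.0ℚ ≡ 0#
  ι-0 = x+x≈x⇒x≈0 _ (≡.sym (≡.trans (cong ι (≡.sym (ℚ.+-identityˡ ℚ.0ℚ))) (ι-+ ℚ.0ℚ ℚ.0ℚ)))

  ι-neg : ∀ q → ι (ℚ.- q) ≡ - ι q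
  ι-neg q = inverseʳ-unique (ι q) (ι (ℚ.- q))
    (≡.trans (≡.sym (ι-+ q (ℚ.- q))) (≡.trans (cong ι (ℚ.+-inverseʳ q)) ι-0))

  cst : ℚ → Poly
  cst q = ι q ∷ []

  two : Poly
  two = cst (ℚ.1ℚ ℚ.+ ℚ.1ℚ)

  2ₚ≡two : 2ₚ ≡ two
  2ₚ≡two = cong (_∷ []) (≡.sym (≡.trans (ι-+ ℚ.1ℚ ℚ.1ℚ) (cong₂ _+_ ι-1 ι-1)))

  cst-0 : cst ℚ.0ℚ ≋ []
  cst-0 = ≋-trans (∷-cong ι-0 ≋-refl) (0∷-zero ≋-refl)

  private
    ℚ⟶k[t] : ℚ.+-*-rawRing -Raw-AlmostCommutative⟶ fromCommutativeRing commutativeRingₚ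
    ℚ⟶k[t] = record
      { ⟦_⟧ = cst
      ; +-homo = λ p q → ∷-cong (ι-+ p q) ≋-refl
      ; *-homo = λ p q → ∷-cong (≡.trans (ι-* p q) (≡.sym (K.+-identityʳ _))) ≋-refl
      ; -‿homo = λ q → ∷-cong (ι-neg q) ≋-refl
      ; 0-homo = cst-0
      ; 1-homo = ∷-cong ι-1 ≋-refl }

    cst-≟ : ∀ p q → Maybe (cst p ≋ cst q)
    cst-≟ p q with p ℚ.≟ q
    ... | yes p≡q = just (≡⇒≋ (cong cst p≡q))
    ... | no  _   = nothing

  open Algebra.Solver.Ring ℚ.+-*-rawRing (fromCommutativeRing commutativeRingₚ) ℚ⟶k[t] cst-≟ public
    using (Polynomial; con; _:+_; _:*_; :-_; solve; _:=_)

  𝟐 : ∀ {n} → Polynomial n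
  𝟐 = con (ℚ.1ℚ ℚ.+ ℚ.1ℚ)

  expression-rawRing : ℕ → RawRing 0ℓ 0ℓ
  expression-rawRing n = record
    { Carrier = Polynomial n ; _≈_ = _≡_ ; _+_ = _:+_ ; _*_ = _:*_ ; -_ = :-_
    ; 0# = con ℚ.0ℚ ; 1# = con ℚ.1ℚ }

module PolynomialDivisibility (k : NumberField) where
  open Over k
  open PolynomialRing k
  open PolynomialSolver k
  open CommutativeRing commutativeRingₚ using (semiring; ring)
  open import Algebra.Properties.Semiring.Divisibility semiring public
    using (_∣_; _,_; _∣0; ∣ʳ-respʳ-≈) renaming (x∣ʳy⇒x∣ʳzy to ∣-*ˡ)
  open import Algebra.Properties.Ring ring using (-‿distribˡ-*)

  ∣⇒∣ₚ : ∀ {d p} → d ∣ p → d ∣ₚ p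
  ∣⇒∣ₚ (q , q*d≋p) = q , coeff-≡ q*d≋p

  ∣ₚ⇒∣ : ∀ {d p} → d ∣ₚ p → d ∣ p
  ∣ₚ⇒∣ (q , q*d≈p) = q , coeffwise q*d≈p

  coprime⇒∣1 : ∀ {p q} → Coprime p q → ∀ {d} → d ∣ p → d ∣ q → d ∣ 1ₚ
  coprime⇒∣1 coprime {d} d∣p d∣q = ∣ₚ⇒∣ (coprime d (∣⇒∣ₚ d∣p) (∣⇒∣ₚ d∣q))

  ∣1⇒coprime : ∀ {p q} → (∀ {d} → d ∣ p → d ∣ q → d ∣ 1ₚ) → Coprime p q
  ∣1⇒coprime ∣1 d d∣p d∣q = ∣⇒∣ₚ (∣1 (∣ₚ⇒∣ d∣p) (∣ₚ⇒∣ d∣q))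

  ∣-resp-≋ : ∀ {d p q} → p ≋ q → d ∣ p → d ∣ q
  ∣-resp-≋ = ∣ʳ-respʳ-≈

  ∣-≋0 : ∀ {d p} → p ≋ [] → d ∣ p
  ∣-≋0 {d} p≋0 = ∣-resp-≋ (≋-sym p≋0) (d ∣0)

  ∣-+ : ∀ {d p q} → d ∣ p → d ∣ q → d ∣ p +ₚ q
  ∣-+ {d} (u , u*d≋p) (v , v*d≋q) = u +ₚ v , ≋-trans (*ₚ-distribʳ d u v) (+ₚ-cong u*d≋p v*d≋q)

  ∣-*ʳ : ∀ {d p} q → d ∣ p → d ∣ p *ₚ q
  ∣-*ʳ {p = p} q d∣p = ∣-resp-≋ (*ₚ-comm q p) (∣-*ˡ q d∣p)

  ∣-negₚ : ∀ {d p} → d ∣ p → d ∣ negₚ p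
  ∣-negₚ {d} (u , u*d≋p) = negₚ u , ≋-trans (≋-sym (-‿distribˡ-* u d)) (negₚ-cong u*d≋p)

  ∣-halve : ∀ {d p} → d ∣ p *ₚ two → d ∣ p
  ∣-halve {p = p} d∣2p = ∣-resp-≋ p≋ (∣-*ˡ (cst ℚ.½) d∣2p)
    where
    p≋ : cst ℚ.½ *ₚ (p *ₚ two) ≋ p
    p≋ = ≋-sym (solve 1 (λ p → p := con ℚ.½ :* (p :* 𝟐)) ≋-refl p)

  ∣-unimodular : ∀ {d p x y} u v → u *ₚ x +ₚ v *ₚ y ≋ 1ₚ → d ∣ p *ₚ x → d ∣ p *ₚ y → d ∣ p
  ∣-unimodular {p = p} {x} {y} u v ux+vy≋1 d∣px d∣py = ∣-resp-≋ p≋ (∣-+ (∣-*ˡ u d∣px) (∣-*ˡ v d∣py))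
    where
    p≋ : u *ₚ (p *ₚ x) +ₚ v *ₚ (p *ₚ y) ≋ p
    p≋ = begin
      u *ₚ (p *ₚ x) +ₚ v *ₚ (p *ₚ y)  ≈⟨ solve 5 (λ u v p x y →
                                           u :* (p :* x) :+ v :* (p :* y) := p :* (u :* x :+ v :* y))
                                         ≋-refl u v p x y ⟩
      p *ₚ (u *ₚ x +ₚ v *ₚ y)         ≈⟨ *ₚ-congˡ p ux+vy≋1 ⟩
      p *ₚ 1ₚ                         ≈⟨ *ₚ-identityʳ p ⟩
      p                               ∎
      where open import Relation.Binary.Reasoning.Setoid setoidₚ

-- The polynomial expressions of the argument, written once over a raw ring so that they serve
-- both as elements of k[t] and as solver syntax.
module Formulas (R : RawRing 0ℓ 0ℓ) (two : RawRing.Carrier R) where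
  open RawRing R

  quadratic : (a b c x y : Carrier) → Carrier
  quadratic a b c x y = a * x * x + two * b * x * y + c * y * y

  bilinear : (a b c m n r s : Carrier) → Carrier
  bilinear a b c m n r s = a * m * n + b * (m * s + n * r) + c * r * s

  det : (m n r s : Carrier) → Carrier
  det m n r s = m * s + - (n * r)

  composeˣ : (f x₁ y₁ x₂ y₂ : Carrier) → Carrier
  composeˣ f x₁ y₁ x₂ y₂ = x₁ * x₂ + - (f * y₁ * y₂)

  composeʸ : (A A' E x₁ y₁ x₂ y₂ : Carrier) → Carrier
  composeʸ A A' E x₁ y₁ x₂ y₂ = A * x₁ * y₂ + A' * x₂ * y₁ + two * E * y₁ * y₂

module BinaryForms (k : NumberField) where
  open Over k
  open PolynomialRing k
  open PolynomialSolver k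
  open PolynomialDivisibility k
  open Formulas (CommutativeRing.rawRing commutativeRingₚ) two
  private module ᴱ {n} = Formulas (expression-rawRing n) 𝟐
  open import Relation.Binary.Reasoning.Setoid setoidₚ

  -- eval Q, with its literal coefficient 2ₚ replaced by the solver constant two.
  value : Form → Poly → Poly → Poly
  value Q = quadratic (fa Q) (fb Q) (fc Q)

  eval≡value : ∀ Q x y → eval Q x y ≡ value Q x y
  eval≡value Q x y = cong (λ t → fa Q *ₚ x *ₚ x +ₚ t *ₚ fb Q *ₚ x *ₚ y +ₚ fc Q *ₚ y *ₚ y) 2ₚ≡two

  ≈F-sym : ∀ Q R → Q ≈F R → R ≈F Q
  ≈F-sym _ _ (a≈ , b≈ , c≈) = (λ i → ≡.sym (a≈ i)) , (λ i → ≡.sym (b≈ i)) , (λ i → ≡.sym (c≈ i))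

  value-cong : ∀ Q R {x x' y y'} → Q ≈F R → x ≋ x' → y ≋ y' → value Q x y ≋ value R x' y'
  value-cong Q R (a≈ , b≈ , c≈) x≋ y≋ =
    +ₚ-cong (+ₚ-cong (*ₚ-cong (*ₚ-cong (coeffwise {fa Q} {fa R} a≈) x≋) x≋)
                     (*ₚ-cong (*ₚ-cong (*ₚ-cong (≋-refl {two}) (coeffwise {fb Q} {fb R} b≈)) x≋) y≋))
            (*ₚ-cong (*ₚ-cong (coeffwise {fc Q} {fc R} c≈) y≋) y≋)

  value-argument-cong : ∀ Q {x x' y y'} → x ≋ x' → y ≋ y' → value Q x y ≋ value Q x' y'
  value-argument-cong Q = value-cong Q Q ((λ _ → refl) , (λ _ → refl) , (λ _ → refl))

  value-1-0 : ∀ Q → value Q 1ₚ [] ≋ fa Q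
  value-1-0 Q = begin
    fa Q *ₚ 1ₚ *ₚ 1ₚ +ₚ two *ₚ fb Q *ₚ 1ₚ *ₚ [] +ₚ fc Q *ₚ [] *ₚ []
      ≈⟨ +ₚ-cong (+ₚ-cong ≋-refl (*ₚ-zeroʳ (two *ₚ fb Q *ₚ 1ₚ))) (*ₚ-zeroʳ (fc Q *ₚ [])) ⟩
    fa Q *ₚ 1ₚ *ₚ 1ₚ +ₚ [] +ₚ []
      ≈⟨ ≋-trans (+ₚ-identityʳ _) (+ₚ-identityʳ _) ⟩
    fa Q *ₚ 1ₚ *ₚ 1ₚ
      ≈⟨ ≋-trans (*ₚ-identityʳ _) (*ₚ-identityʳ _) ⟩
    fa Q ∎

  det≋1 : ∀ M → det (SL2.m M) (SL2.n M) (SL2.r M) (SL2.s M) ≋ 1ₚ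
  det≋1 M = coeffwise (SL2.det≡1 M)

  quadratic-substitution : ∀ a b c m n r s x y →
    quadratic (quadratic a b c m r) (bilinear a b c m n r s) (quadratic a b c n s) x y
      ≋ quadratic a b c (m *ₚ x +ₚ n *ₚ y) (r *ₚ x +ₚ s *ₚ y)
  quadratic-substitution = solve 9 (λ a b c m n r s x y →
    ᴱ.quadratic (ᴱ.quadratic a b c m r) (ᴱ.bilinear a b c m n r s) (ᴱ.quadratic a b c n s) x y
      := ᴱ.quadratic a b c (m :* x :+ n :* y) (r :* x :+ s :* y)) ≋-refl

  value-act : ∀ Q M x y → let open SL2 M in
    value (act Q M) x y ≋ value Q (m *ₚ x +ₚ n *ₚ y) (r *ₚ x +ₚ s *ₚ y)
  value-act Q (mat m n r s _) x y = ≋-trans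
    (≡⇒≋ (cong₂ (λ A C → quadratic A (bilinear (fa Q) (fb Q) (fc Q) m n r s) C x y)
                (eval≡value Q m r) (eval≡value Q n s)))
    (quadratic-substitution (fa Q) (fb Q) (fc Q) m n r s x y)

  -- (s, -r) is the first column of M⁻¹.
  inv₁₁ inv₂₁ : SL2 → Poly
  inv₁₁ M = SL2.s M
  inv₂₁ M = negₚ (SL2.r M)

  mul-inverse-column₁ : ∀ m n r s → m *ₚ s +ₚ n *ₚ negₚ r ≋ det m n r s
  mul-inverse-column₁ = solve 4 (λ m n r s → m :* s :+ n :* :- r := ᴱ.det m n r s) ≋-refl

  mul-inverse-column₂ : ∀ r s → r *ₚ s +ₚ s *ₚ negₚ r ≋ []
  mul-inverse-column₂ r s = ≋-trans (solve 2 (λ r s → r :* s :+ s :* :- r := con ℚ.0ℚ) ≋-refl r s) cst-0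

  inverse-column-unimodular : ∀ M → SL2.m M *ₚ inv₁₁ M +ₚ SL2.n M *ₚ inv₂₁ M ≋ 1ₚ
  inverse-column-unimodular M@(mat m n r s _) = ≋-trans (mul-inverse-column₁ m n r s) (det≋1 M)

  value-at-inverse-column : ∀ Q F M → act Q M ≈F F → value F (inv₁₁ M) (inv₂₁ M) ≋ fa Q
  value-at-inverse-column Q F M@(mat m n r s _) QM≈F = begin
    value F s (negₚ r)
      ≈⟨ value-cong F (act Q M) (≈F-sym (act Q M) F QM≈F) ≋-refl ≋-refl ⟩
    value (act Q M) s (negₚ r)
      ≈⟨ value-act Q M s (negₚ r) ⟩
    value Q (m *ₚ s +ₚ n *ₚ negₚ r) (r *ₚ s +ₚ s *ₚ negₚ r)
      ≈⟨ value-argument-cong Q (inverse-column-unimodular M) (mul-inverse-column₂ r s) ⟩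
    value Q 1ₚ []
      ≈⟨ value-1-0 Q ⟩
    fa Q ∎

  mul-adjugate₁ : ∀ m n r s X Y →
    m *ₚ (s *ₚ X -ₚ n *ₚ Y) +ₚ n *ₚ (m *ₚ Y -ₚ r *ₚ X) ≋ det m n r s *ₚ X
  mul-adjugate₁ = solve 6 (λ m n r s X Y →
    m :* (s :* X :+ :- (n :* Y)) :+ n :* (m :* Y :+ :- (r :* X)) := ᴱ.det m n r s :* X) ≋-refl

  mul-adjugate₂ : ∀ m n r s X Y →
    r *ₚ (s *ₚ X -ₚ n *ₚ Y) +ₚ s *ₚ (m *ₚ Y -ₚ r *ₚ X) ≋ det m n r s *ₚ Y
  mul-adjugate₂ = solve 6 (λ m n r s X Y →
    r :* (s :* X :+ :- (n :* Y)) :+ s :* (m :* Y :+ :- (r :* X)) := ᴱ.det m n r s :* Y) ≋-refl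

  quadratic-compose : ∀ A A' E f x₁ y₁ x₂ y₂ →
    quadratic (A *ₚ A') E f (composeˣ f x₁ y₁ x₂ y₂) (composeʸ A A' E x₁ y₁ x₂ y₂)
      ≋ quadratic A E (A' *ₚ f) x₁ y₁ *ₚ quadratic A' E (A *ₚ f) x₂ y₂
  quadratic-compose = solve 8 (λ A A' E f x₁ y₁ x₂ y₂ →
    ᴱ.quadratic (A :* A') E f (ᴱ.composeˣ f x₁ y₁ x₂ y₂) (ᴱ.composeʸ A A' E x₁ y₁ x₂ y₂)
      := ᴱ.quadratic A E (A' :* f) x₁ y₁ :* ᴱ.quadratic A' E (A :* f) x₂ y₂) ≋-refl

  quadratic-*ˣ : ∀ A A' E f x₁ y₁ x₂ y₂ →
    quadratic A E (A' *ₚ f) x₁ y₁ *ₚ x₂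
      ≋ (A *ₚ x₁ +ₚ two *ₚ E *ₚ y₁) *ₚ composeˣ f x₁ y₁ x₂ y₂ +ₚ f *ₚ y₁ *ₚ composeʸ A A' E x₁ y₁ x₂ y₂
  quadratic-*ˣ = solve 8 (λ A A' E f x₁ y₁ x₂ y₂ →
    ᴱ.quadratic A E (A' :* f) x₁ y₁ :* x₂
      := (A :* x₁ :+ 𝟐 :* E :* y₁) :* ᴱ.composeˣ f x₁ y₁ x₂ y₂ :+ f :* y₁ :* ᴱ.composeʸ A A' E x₁ y₁ x₂ y₂)
    ≋-refl

  quadratic-*ʸ : ∀ A A' E f x₁ y₁ x₂ y₂ →
    quadratic A E (A' *ₚ f) x₁ y₁ *ₚ y₂
      ≋ negₚ (A' *ₚ y₁) *ₚ composeˣ f x₁ y₁ x₂ y₂ +ₚ x₁ *ₚ composeʸ A A' E x₁ y₁ x₂ y₂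
  quadratic-*ʸ = solve 8 (λ A A' E f x₁ y₁ x₂ y₂ →
    ᴱ.quadratic A E (A' :* f) x₁ y₁ :* y₂
      := :- (A' :* y₁) :* ᴱ.composeˣ f x₁ y₁ x₂ y₂ :+ x₁ :* ᴱ.composeʸ A A' E x₁ y₁ x₂ y₂) ≋-refl

  composeˣ-comm : ∀ f x₁ y₁ x₂ y₂ → composeˣ f x₁ y₁ x₂ y₂ ≋ composeˣ f x₂ y₂ x₁ y₁
  composeˣ-comm = solve 5 (λ f x₁ y₁ x₂ y₂ →
    ᴱ.composeˣ f x₁ y₁ x₂ y₂ := ᴱ.composeˣ f x₂ y₂ x₁ y₁) ≋-refl

  composeʸ-comm : ∀ A A' E x₁ y₁ x₂ y₂ → composeʸ A A' E x₁ y₁ x₂ y₂ ≋ composeʸ A' A E x₂ y₂ x₁ y₁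
  composeʸ-comm = solve 7 (λ A A' E x₁ y₁ x₂ y₂ →
    ᴱ.composeʸ A A' E x₁ y₁ x₂ y₂ := ᴱ.composeʸ A' A E x₂ y₂ x₁ y₁) ≋-refl

  composeʸ-cong : ∀ {A₀ A A₀' A' E₀ E} x₁ y₁ x₂ y₂ → A₀ ≋ A → A₀' ≋ A' → E₀ ≋ E →
    composeʸ A₀ A₀' E₀ x₁ y₁ x₂ y₂ ≋ composeʸ A A' E x₁ y₁ x₂ y₂
  composeʸ-cong x₁ y₁ x₂ y₂ A≋ A'≋ E≋ =
    +ₚ-cong (+ₚ-cong (*ₚ-congʳ y₂ (*ₚ-congʳ x₁ A≋)) (*ₚ-congʳ y₁ (*ₚ-congʳ x₂ A'≋)))
            (*ₚ-congʳ y₂ (*ₚ-congʳ y₁ (*ₚ-congˡ two E≋)))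

  -- d divides F(x₁, y₁)·x₂ and F(x₁, y₁)·y₂, and (x₂, y₂) is unimodular.
  ∣composite⇒∣fa : ∀ Q A A' E f M M' → act Q M ≈F form A E (A' *ₚ f) → ∀ {d} →
    d ∣ composeˣ f (inv₁₁ M) (inv₂₁ M) (inv₁₁ M') (inv₂₁ M') →
    d ∣ composeʸ A A' E (inv₁₁ M) (inv₂₁ M) (inv₁₁ M') (inv₂₁ M') →
    d ∣ fa Q
  ∣composite⇒∣fa Q A A' E f M M' QM≈F d∣X d∣Y =
    ∣-resp-≋ (value-at-inverse-column Q (form A E (A' *ₚ f)) M QM≈F)
      (∣-unimodular (SL2.m M') (SL2.n M') (inverse-column-unimodular M')
        (∣-resp-≋ (≋-sym (quadratic-*ˣ A A' E f x₁ y₁ x₂ y₂))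
          (∣-+ (∣-*ˡ (A *ₚ x₁ +ₚ two *ₚ E *ₚ y₁) d∣X) (∣-*ˡ (f *ₚ y₁) d∣Y)))
        (∣-resp-≋ (≋-sym (quadratic-*ʸ A A' E f x₁ y₁ x₂ y₂))
          (∣-+ (∣-*ˡ (negₚ (A' *ₚ y₁)) d∣X) (∣-*ˡ x₁ d∣Y))))
    where
    x₁ = inv₁₁ M
    y₁ = inv₂₁ M
    x₂ = inv₁₁ M'
    y₂ = inv₂₁ M'

  record Composition (Q Q' R : Form) : Set where
    field
      A A' E f : Poly
      M M' N   : SL2
      QM≈F     : act Q M ≈F form A E (A' *ₚ f)
      Q'M'≈G   : act Q' M' ≈F form A' E (A *ₚ f)
      HN≈R     : act (form (A *ₚ A') E f) N ≈F R

  inComposite⇒composition : ∀ {D Q Q' R} → InComposite D Q Q' R → Composition Q Q' R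
  inComposite⇒composition
    (_ , Q₁ , Q₁' , e , f , _ , _ , _ , _ , _ , _ , (M , QM≈F) , _ , (M' , Q'M'≈G) , _ , (N , HN≈R)) =
    record { A = fa Q₁ ; A' = fa Q₁' ; E = e ; f = f ; M = M ; M' = M' ; N = N
           ; QM≈F = QM≈F ; Q'M'≈G = Q'M'≈G ; HN≈R = HN≈R }

  module Composite {Q Q' R : Form} (C : Composition Q Q' R) where
    open Composition C

    F G H : Form
    F = form A E (A' *ₚ f)
    G = form A' E (A *ₚ f)
    H = form (A *ₚ A') E f

    x₁ y₁ x₂ y₂ X Y : Poly
    x₁ = inv₁₁ M
    y₁ = inv₂₁ M
    x₂ = inv₁₁ M'
    y₂ = inv₂₁ M'
    X = composeˣ f x₁ y₁ x₂ y₂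
    Y = composeʸ A A' E x₁ y₁ x₂ y₂

    open SL2 N

    -- (x, y) = N⁻¹ (X, Y)
    x y : Poly
    x = s *ₚ X -ₚ n *ₚ Y
    y = m *ₚ Y -ₚ r *ₚ X

    N-x,y≋X : m *ₚ x +ₚ n *ₚ y ≋ X
    N-x,y≋X = ≋-trans (mul-adjugate₁ m n r s X Y) (≋-trans (*ₚ-congʳ X (det≋1 N)) (*ₚ-identityˡ X))

    N-x,y≋Y : r *ₚ x +ₚ s *ₚ y ≋ Y
    N-x,y≋Y = ≋-trans (mul-adjugate₂ m n r s X Y) (≋-trans (*ₚ-congʳ Y (det≋1 N)) (*ₚ-identityˡ Y))

    eval-R : eval R x y ≋ fa Q *ₚ fa Q'
    eval-R = begin
      eval R x y                                     ≡⟨ eval≡value R x y ⟩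
      value R x y                                    ≈⟨ value-cong (act H N) R HN≈R ≋-refl ≋-refl ⟨
      value (act H N) x y                            ≈⟨ value-act H N x y ⟩
      value H (m *ₚ x +ₚ n *ₚ y) (r *ₚ x +ₚ s *ₚ y)  ≈⟨ value-argument-cong H N-x,y≋X N-x,y≋Y ⟩
      value H X Y                                    ≈⟨ quadratic-compose A A' E f x₁ y₁ x₂ y₂ ⟩
      value F x₁ y₁ *ₚ value G x₂ y₂                 ≈⟨ *ₚ-cong (value-at-inverse-column Q F M QM≈F)
                                                                 (value-at-inverse-column Q' G M' Q'M'≈G) ⟩
      fa Q *ₚ fa Q'                                  ∎

    ∣xy⇒∣XY : ∀ {d} → d ∣ x → d ∣ y → d ∣ X × d ∣ Y
    ∣xy⇒∣XY d∣x d∣y = ∣-resp-≋ N-x,y≋X (∣-+ (∣-*ˡ m d∣x) (∣-*ˡ n d∣y))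
                    , ∣-resp-≋ N-x,y≋Y (∣-+ (∣-*ˡ r d∣x) (∣-*ˡ s d∣y))

    ∣XY⇒∣a : ∀ {d} → d ∣ X → d ∣ Y → d ∣ fa Q
    ∣XY⇒∣a = ∣composite⇒∣fa Q A A' E f M M' QM≈F

    ∣XY⇒∣a' : ∀ {d} → d ∣ X → d ∣ Y → d ∣ fa Q'
    ∣XY⇒∣a' d∣X d∣Y = ∣composite⇒∣fa Q' A' A E f M' M Q'M'≈G
      (∣-resp-≋ (composeˣ-comm f x₁ y₁ x₂ y₂) d∣X) (∣-resp-≋ (composeʸ-comm A A' E x₁ y₁ x₂ y₂) d∣Y)

    properly-represents : (∀ {d} → d ∣ X → d ∣ Y → d ∣ 1ₚ) → ProperlyRepresents R (fa Q *ₚ fa Q')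
    properly-represents XY-coprime =
      x , y , ∣1⇒coprime (λ d∣x d∣y → uncurry XY-coprime (∣xy⇒∣XY d∣x d∣y)) , coeff-≡ eval-R

  module SameClassIdentities (a b c m n r s m' n' r' s' : Poly) where
    E₁ E₂ δ δ' : Poly
    E₁ = bilinear a b c m n r s
    E₂ = bilinear a b c m' n' r' s'
    δ = det m n r s
    δ' = det m' n' r' s'

    composeʸ-same-class : b *ₚ r *ₚ r' *ₚ (δ +ₚ δ')
      ≋ r *ₚ r' *ₚ (E₁ -ₚ E₂)
        -ₚ a *ₚ (m *ₚ m *ₚ s *ₚ r' +ₚ m' *ₚ m' *ₚ s' *ₚ r -ₚ (m *ₚ n +ₚ m' *ₚ n') *ₚ r *ₚ r')
        -ₚ composeʸ (quadratic a b c m r) (quadratic a b c m' r') E₁ s (negₚ r) s' (negₚ r')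
    composeʸ-same-class = solve 11 (λ a b c m n r s m' n' r' s' →
      b :* r :* r' :* (ᴱ.det m n r s :+ ᴱ.det m' n' r' s')
        := r :* r' :* (ᴱ.bilinear a b c m n r s :+ :- ᴱ.bilinear a b c m' n' r' s')
          :+ :- (a :* (m :* m :* s :* r' :+ m' :* m' :* s' :* r :+ :- ((m :* n :+ m' :* n') :* r :* r')))
          :+ :- ᴱ.composeʸ (ᴱ.quadratic a b c m r) (ᴱ.quadratic a b c m' r') (ᴱ.bilinear a b c m n r s)
                           s (:- r) s' (:- r'))
      ≋-refl a b c m n r s m' n' r' s'

    composeˣ-same-class : ∀ f →
      b *ₚ s *ₚ s' ≋ b *ₚ composeˣ f s (negₚ r) s' (negₚ r') +ₚ b *ₚ r *ₚ r' *ₚ f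
    composeˣ-same-class f = solve 6 (λ b r s r' s' f →
      b :* s :* s' := b :* ᴱ.composeˣ f s (:- r) s' (:- r') :+ b :* r :* r' :* f) ≋-refl b r s r' s' f

    bilinear-difference : b *ₚ b *ₚ s *ₚ r' *ₚ (δ +ₚ δ')
      ≋ b *ₚ s *ₚ r' *ₚ (E₁ -ₚ E₂)
        -ₚ a *ₚ (b *ₚ s *ₚ r' *ₚ (m *ₚ n -ₚ m' *ₚ n'))
        -ₚ b *ₚ r *ₚ r' *ₚ (two *ₚ b *ₚ n *ₚ s +ₚ c *ₚ s *ₚ s)
        +ₚ b *ₚ s *ₚ s' *ₚ (two *ₚ b *ₚ m' *ₚ r' +ₚ c *ₚ r' *ₚ r')
    bilinear-difference = solve 11 (λ a b c m n r s m' n' r' s' →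
      b :* b :* s :* r' :* (ᴱ.det m n r s :+ ᴱ.det m' n' r' s')
        := b :* s :* r' :* (ᴱ.bilinear a b c m n r s :+ :- ᴱ.bilinear a b c m' n' r' s')
          :+ :- (a :* (b :* s :* r' :* (m :* n :+ :- (m' :* n'))))
          :+ :- (b :* r :* r' :* (𝟐 :* b :* n :* s :+ c :* s :* s))
          :+ b :* s :* s' :* (𝟐 :* b :* m' :* r' :+ c :* r' :* r'))
      ≋-refl a b c m n r s m' n' r' s'

    product-of-dets : b *ₚ b *ₚ (δ *ₚ δ')
      ≋ b *ₚ s *ₚ s' *ₚ (b *ₚ m *ₚ m') -ₚ b *ₚ b *ₚ s *ₚ r' *ₚ (m *ₚ n')
        -ₚ b *ₚ b *ₚ s' *ₚ r *ₚ (n *ₚ m') +ₚ b *ₚ r *ₚ r' *ₚ (b *ₚ n *ₚ n')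
    product-of-dets = solve 9 (λ b m n r s m' n' r' s' →
      b :* b :* (ᴱ.det m n r s :* ᴱ.det m' n' r' s')
        := b :* s :* s' :* (b :* m :* m') :+ :- (b :* b :* s :* r' :* (m :* n'))
          :+ :- (b :* b :* s' :* r :* (n :* m')) :+ b :* r :* r' :* (b :* n :* n'))
      ≋-refl b m n r s m' n' r' s'

  module SameClass (Q : Form) (A A' E f : Poly) (M M' : SL2)
    (QM≈F : act Q M ≈F form A E (A' *ₚ f)) (QM'≈G : act Q M' ≈F form A' E (A *ₚ f))
    {d : Poly}
    (d∣X : d ∣ composeˣ f (inv₁₁ M) (inv₂₁ M) (inv₁₁ M') (inv₂₁ M'))
    (d∣Y : d ∣ composeʸ A A' E (inv₁₁ M) (inv₂₁ M) (inv₁₁ M') (inv₂₁ M')) where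
    open SL2 M using (m; n; r; s)
    open SL2 M' using () renaming (m to m'; n to n'; r to r'; s to s')

    a b c : Poly
    a = fa Q
    b = fb Q
    c = fc Q

    open SameClassIdentities a b c m n r s m' n' r' s' public

    d∣a : d ∣ a
    d∣a = ∣composite⇒∣fa Q A A' E f M M' QM≈F d∣X d∣Y

    E₁-E₂≋0 : E₁ -ₚ E₂ ≋ []
    E₁-E₂≋0 = ≋-trans (+ₚ-cong (≋-trans (coeffwise {E₁} {E} (proj₁ (proj₂ QM≈F)))
                                        (≋-sym (coeffwise {E₂} {E} (proj₁ (proj₂ QM'≈G)))))
                               ≋-refl)
                      (+ₚ-inverseʳ E₂)

    δ+δ'≋two : δ +ₚ δ' ≋ two
    δ+δ'≋two = ≋-trans (+ₚ-cong (det≋1 M) (det≋1 M')) (≡⇒≋ 2ₚ≡two)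

    Y≋ : composeʸ A A' E s (negₚ r) s' (negₚ r')
       ≋ composeʸ (quadratic a b c m r) (quadratic a b c m' r') E₁ s (negₚ r) s' (negₚ r')
    Y≋ = composeʸ-cong s (negₚ r) s' (negₚ r')
      (≋-trans (≋-sym (coeffwise {eval Q m r} {A} (proj₁ QM≈F))) (≡⇒≋ (eval≡value Q m r)))
      (≋-trans (≋-sym (coeffwise {eval Q m' r'} {A'} (proj₁ QM'≈G))) (≡⇒≋ (eval≡value Q m' r')))
      (≋-sym (coeffwise {E₁} {E} (proj₁ (proj₂ QM≈F))))

    ∣-vanishing : ∀ p → d ∣ p *ₚ (E₁ -ₚ E₂)
    ∣-vanishing p = ∣-≋0 (≋-trans (*ₚ-congˡ p E₁-E₂≋0) (*ₚ-zeroʳ p))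

    d∣brr' : d ∣ b *ₚ r *ₚ r'
    d∣brr' = ∣-halve (∣-resp-≋ (≋-trans (≋-sym composeʸ-same-class) (*ₚ-congˡ (b *ₚ r *ₚ r') δ+δ'≋two))
      (∣-+ (∣-+ (∣-vanishing (r *ₚ r')) (∣-negₚ (∣-*ʳ _ d∣a))) (∣-negₚ (∣-resp-≋ Y≋ d∣Y))))

    d∣bss' : d ∣ b *ₚ s *ₚ s'
    d∣bss' = ∣-resp-≋ (≋-sym (composeˣ-same-class f)) (∣-+ (∣-*ˡ b d∣X) (∣-*ʳ f d∣brr'))

    d∣bbsr' : d ∣ b *ₚ b *ₚ s *ₚ r'
    d∣bbsr' = ∣-halve (∣-resp-≋
      (≋-trans (≋-sym bilinear-difference) (*ₚ-congˡ (b *ₚ b *ₚ s *ₚ r') δ+δ'≋two))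
      (∣-+ (∣-+ (∣-+ (∣-vanishing (b *ₚ s *ₚ r')) (∣-negₚ (∣-*ʳ _ d∣a)))
                (∣-negₚ (∣-*ʳ _ d∣brr')))
           (∣-*ʳ _ d∣bss')))

  ∣XY⇒∣disc : ∀ {Q R} (C : Composition Q Q R) → let open Composite C in
    ∀ {d} → d ∣ X → d ∣ Y → d ∣ disc Q
  ∣XY⇒∣disc {Q} C {d} d∣X d∣Y = ∣-+ d∣bb (∣-negₚ (∣-*ʳ c d∣a))
    where
    open Composition C
    open Composite C using (x₁; y₁; x₂; y₂)
    open SameClass Q A A' E f M M' QM≈F Q'M'≈G d∣X d∣Y
    module Swapped = SameClass Q A' A E f M' M Q'M'≈G QM≈F
      (∣-resp-≋ (composeˣ-comm f x₁ y₁ x₂ y₂) d∣X) (∣-resp-≋ (composeʸ-comm A A' E x₁ y₁ x₂ y₂) d∣Y)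

    δδ'≋1 : δ *ₚ δ' ≋ 1ₚ
    δδ'≋1 = ≋-trans (*ₚ-cong (det≋1 M) (det≋1 M')) (*ₚ-identityˡ 1ₚ)

    d∣bb : d ∣ b *ₚ b
    d∣bb = ∣-resp-≋
      (≋-trans (≋-sym product-of-dets) (≋-trans (*ₚ-congˡ (b *ₚ b) δδ'≋1) (*ₚ-identityʳ (b *ₚ b))))
      (∣-+ (∣-+ (∣-+ (∣-*ʳ _ d∣bss') (∣-negₚ (∣-*ʳ _ d∣bbsr'))) (∣-negₚ (∣-*ʳ _ Swapped.d∣bbsr')))
           (∣-*ʳ _ d∣brr'))

proposition4 : (k : NumberField) → let open Over k in
    (D : Poly) → Negative D → SquareFree D → OddDegree D →
    (Q Q' : Form) → InQ D Q → InQ D Q' →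
    ((Coprime (fa Q) (fa Q') →
        ∀ R → InComposite D Q Q' R → ProperlyRepresents R (fa Q *ₚ fa Q'))
     ×
     (Coprime (fa Q) D →
        ∀ R → InComposite D Q Q R → ProperlyRepresents R (fa Q *ₚ fa Q)))
proposition4 k D _ _ _ Q Q' (disc≈D , _) _ = part-i , part-ii
  where
  open Over k
  open PolynomialRing k
  open PolynomialDivisibility k
  open BinaryForms k

  part-i : Coprime (fa Q) (fa Q') → ∀ R → InComposite D Q Q' R → ProperlyRepresents R (fa Q *ₚ fa Q')
  part-i coprime R R∈QQ' = properly-represents λ d∣X d∣Y →
    coprime⇒∣1 coprime (∣XY⇒∣a d∣X d∣Y) (∣XY⇒∣a' d∣X d∣Y)
    where open Composite (inComposite⇒composition {D} {Q} {Q'} {R} R∈QQ')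

  part-ii : Coprime (fa Q) D → ∀ R → InComposite D Q Q R → ProperlyRepresents R (fa Q *ₚ fa Q)
  part-ii coprime R R∈QQ = properly-represents λ d∣X d∣Y →
    coprime⇒∣1 coprime (∣XY⇒∣a d∣X d∣Y) (∣-resp-≋ (coeffwise {disc Q} {D} disc≈D) (∣XY⇒∣disc C d∣X d∣Y))
    where
    C : Composition Q Q R
    C = inComposite⇒composition {D} R∈QQ
    open Composite C
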